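{- For any integer $m>4$, there is a positive integer $n$ such that $\pi(mn)=m+n$.
   Context: For real $x>0$, $\pi(x)$ denotes the number of primes not exceeding $x$. -}

module Defs where

open import Data.Nat using (ℕ; zero; suc; _+_)
open import Data.Nat.Primality using (prime?)
open import Relation.Nullary.Decidable using (Dec; yes; no)

π : ℕ → ℕ
π zero = 0
π (suc n) with prime? (suc n)
... | yes _ = suc (π n)
... | no _  = π n

-- Let f(n) = π(mn) − (m + n). As π is nondecreasing, f(n + 1) ≥ f(n) − 1, so a zero of f lies
-- between any a with f(a) ≥ 0 and any b > a with f(b) ≤ 0.
-- Upper end: Chebyshev's bound ∏_{p ≤ x} p ≤ 4^x (the primes in (k + 1, 2k + 1] divide C(2k+1, k+1) ≤ 4^k)
-- shows that the primes in (4^(2m), mb] number at most b/2, hence π(mb) ≤ b once b ≥ 2·4^(2m).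
-- Lower end: every k·C(n, k) divides lcm(1, …, n) ≤ n^π(n) (Leibniz's harmonic triangle), so
-- 4^N ≤ 2N·C(2N, N) ≤ 2·(2N)^π(2N); for 2^q ≤ m < 2^(q+1) this yields f(2^(q+1)) ≥ 0 when m ≥ 16,
-- and the cases 5 ≤ m < 16 are decided by evaluation.

{-# OPTIONS --safe #-}
module Submission where

open import Defs
open import Data.Nat
open import Data.Nat.Properties
open import Data.Nat.Combinatorics
open import Data.Nat.DivMod using (m/n*n≡m)
open import Data.Nat.Divisibility
open import Data.Nat.Tactic.RingSolver using (solve-∀)
open import Data.Product using (∃-syntax; _×_; _,_)
open import Data.List using ([]; _∷_)
open import Data.List.Relation.Unary.All using (_∷_)
open import Data.Nat.ListAction using (product)
open import Data.Nat.Primality.Factorisation using (factorise)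
open import Relation.Binary.PropositionalEquality
open import Relation.Nullary using (¬_; contradiction; yes; no)
open import Data.Nat.Primality
open import Data.Sum using (_⊎_; inj₁; inj₂)
open import Induction.WellFounded using (Acc; acc)
open import Data.Nat.Induction using (<-wellFounded)
open import Function using (_∘_)

^-cancelʳ-≤ : ∀ b → b > 1 → ∀ {u v} → b ^ u ≤ b ^ v → u ≤ v
^-cancelʳ-≤ b b>1 {u} {v} b^u≤b^v with u ≤? v
... | yes u≤v = u≤v
... | no  u≰v = contradiction b^u≤b^v (<⇒≱ (^-monoʳ-< b b>1 (≰⇒> u≰v)))

^-cancelʳ-< : ∀ b .{{_ : NonZero b}} {u v} → b ^ u < b ^ v → u < v
^-cancelʳ-< b {u} {v} b^u<b^v with u <? v
... | yes u<v = u<v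
... | no  u≮v = contradiction b^u<b^v (≤⇒≯ (^-monoʳ-≤ b (≮⇒≥ u≮v)))

^-monoʳ-∣ : ∀ b {u v} → u ≤ v → b ^ u ∣ b ^ v
^-monoʳ-∣ b {u} {v} u≤v = subst (b ^ u ∣_) b^u*b^[v∸u]≡b^v (m∣m*n (b ^ (v ∸ u)))
  where
  b^u*b^[v∸u]≡b^v : b ^ u * b ^ (v ∸ u) ≡ b ^ v
  b^u*b^[v∸u]≡b^v = trans (sym (^-distribˡ-+-* b u (v ∸ u))) (cong (b ^_) (m+[n∸m]≡n u≤v))

3*[n+n]<2^n : ∀ n → n ≥ 5 → 3 * (n + n) < 2 ^ n
3*[n+n]<2^n n n≥5 with m≤n⇒∃[o]m+o≡n n≥5
... | i , refl = go i
  where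
  go : ∀ i → 3 * ((5 + i) + (5 + i)) < 2 ^ (5 + i)
  go zero    = <ᵇ⇒< 30 32 _
  go (suc i) = begin-strict
    3 * ((6 + i) + (6 + i))    ≡⟨ expand i ⟩
    3 * ((5 + i) + (5 + i)) + 6 <⟨ +-monoˡ-< 6 (go i) ⟩
    2 ^ (5 + i) + 6             ≤⟨ +-monoʳ-≤ (2 ^ (5 + i)) (≤-trans (≤ᵇ⇒≤ 6 8 _) (^-monoʳ-≤ 2 {3} {5 + i} (s≤s (s≤s (s≤s z≤n))))) ⟩
    2 ^ (5 + i) + 2 ^ (5 + i)   ≡⟨ cong (2 ^ (5 + i) +_) (+-identityʳ _) ⟨
    2 ^ (6 + i)                 ∎
    where
    open ≤-Reasoning
    expand : ∀ i → 3 * ((6 + i) + (6 + i)) ≡ 3 * ((5 + i) + (5 + i)) + 6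
    expand = solve-∀

maxPower : ∀ p → p > 1 → ∀ n → ∃[ k ] (p ^ k ≤ suc n × suc n < p ^ suc k)
maxPower p p>1 zero    = 0 , ≤-refl , subst (1 <_) (sym (*-identityʳ p)) p>1
maxPower p p>1 (suc n) with maxPower p p>1 n
... | k , p^k≤1+n , 1+n<p^[1+k] with suc (suc n) <? p ^ suc k
...   | yes 2+n<p^[1+k] = k , m≤n⇒m≤1+n p^k≤1+n , 2+n<p^[1+k]
...   | no  2+n≮p^[1+k] = suc k , ≤-reflexive (sym 2+n≡p^[1+k]) ,
          subst (_< p ^ suc (suc k)) (sym 2+n≡p^[1+k]) p^[1+k]<p^[2+k]
  where
  2+n≡p^[1+k] : suc (suc n) ≡ p ^ suc k
  2+n≡p^[1+k] = ≤-antisym 1+n<p^[1+k] (≮⇒≥ 2+n≮p^[1+k])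
  p^[1+k]<p^[2+k] : p ^ suc k < p ^ suc (suc k)
  p^[1+k]<p^[2+k] = ^-monoʳ-< p p>1 (n<1+n (suc k))

factorOutPower : ∀ p → p > 1 → ∀ j → j > 0 → ∃[ a ] ∃[ r ] (j ≡ p ^ a * r × p ∤ r)
factorOutPower p p>1 j j>0 = go j j>0 (<-wellFounded j)
  where
  go : ∀ j → j > 0 → Acc _<_ j → ∃[ a ] ∃[ r ] (j ≡ p ^ a * r × p ∤ r)
  go j j>0 (acc rec) with p ∣? j
  ... | no  p∤j = 0 , j , sym (+-identityʳ j) , p∤j
  ... | yes (divides q j≡q*p) with go q q>0 (rec q<j)
    where
    q>0 : q > 0
    q>0 = n≢0⇒n>0 λ { refl → <⇒≢ j>0 (sym j≡q*p) }
    q<j : q < j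
    q<j = subst (q <_) (sym j≡q*p) (m<m*n q p {{>-nonZero q>0}} p>1)
  ... | a , r , q≡p^a*r , p∤r = suc a , r , trans j≡q*p (trans (cong (_* p) q≡p^a*r) (rearrange (p ^ a) r p)) , p∤r
    where
    rearrange : ∀ x r p → x * r * p ≡ p * x * r
    rearrange = solve-∀

even⊎odd : ∀ n → ∃[ k ] (n ≡ k + k ⊎ n ≡ suc (k + k))
even⊎odd zero = 0 , inj₁ refl
even⊎odd (suc n) with even⊎odd n
... | k , inj₁ n≡2k   = k , inj₂ (cong suc n≡2k)
... | k , inj₂ n≡2k+1 = suc k , inj₁ (trans (cong suc n≡2k+1) (cong suc (sym (+-suc k k))))

[1+k]*[1+n]C[1+k]≡[1+n]*nCk : ∀ n k → suc k * (suc n C suc k) ≡ suc n * (n C k)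
[1+k]*[1+n]C[1+k]≡[1+n]*nCk zero    zero    = refl
[1+k]*[1+n]C[1+k]≡[1+n]*nCk zero    (suc k) = *-zeroʳ (suc (suc k))
[1+k]*[1+n]C[1+k]≡[1+n]*nCk (suc n) zero    =
  trans (+-identityʳ _) (trans (nC1≡n (suc (suc n))) (sym (*-identityʳ _)))
[1+k]*[1+n]C[1+k]≡[1+n]*nCk (suc n) (suc k) = begin
  suc (suc k) * (suc (suc n) C suc (suc k))
    ≡⟨ cong (suc (suc k) *_) (nCk+nC[k+1]≡[n+1]C[k+1] (suc n) (suc k)) ⟨
  suc (suc k) * (x + y)                          ≡⟨ expand (suc k) x y ⟩
  (suc k * x + suc (suc k) * y) + x
    ≡⟨ cong₂ (λ u v → (u + v) + x) ([1+k]*[1+n]C[1+k]≡[1+n]*nCk n k)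
                                    ([1+k]*[1+n]C[1+k]≡[1+n]*nCk n (suc k)) ⟩
  (suc n * (n C k) + suc n * (n C suc k)) + x    ≡⟨ cong (_+ x) (*-distribˡ-+ (suc n) (n C k) (n C suc k)) ⟨
  suc n * (n C k + n C suc k) + x                ≡⟨ cong (λ u → suc n * u + x) (nCk+nC[k+1]≡[n+1]C[k+1] n k) ⟩
  suc n * x + x                                  ≡⟨ +-comm (suc n * x) x ⟩
  suc (suc n) * x                                ∎
  where
  open ≡-Reasoning
  x = suc n C suc k
  y = suc n C suc (suc k)
  expand : ∀ a x y → suc a * (x + y) ≡ (a * x + suc a * y) + x
  expand = solve-∀

[1+k]*[1+n]C[1+k]+[1+n]*nC[1+k]≡[1+n]*[1+n]C[1+k] : ∀ n k →
  suc k * (suc n C suc k) + suc n * (n C suc k) ≡ suc n * (suc n C suc k)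
[1+k]*[1+n]C[1+k]+[1+n]*nC[1+k]≡[1+n]*[1+n]C[1+k] n k = begin
  suc k * (suc n C suc k) + suc n * (n C suc k)  ≡⟨ cong (_+ suc n * (n C suc k)) ([1+k]*[1+n]C[1+k]≡[1+n]*nCk n k) ⟩
  suc n * (n C k) + suc n * (n C suc k)          ≡⟨ *-distribˡ-+ (suc n) (n C k) (n C suc k) ⟨
  suc n * (n C k + n C suc k)                    ≡⟨ cong (suc n *_) (nCk+nC[k+1]≡[n+1]C[k+1] n k) ⟩
  suc n * (suc n C suc k)                        ∎
  where open ≡-Reasoning

nCk*[k!*[n∸k]!]≡n! : ∀ {n k} → k ≤ n → (n C k) * (k ! * (n ∸ k) !) ≡ n !
nCk*[k!*[n∸k]!]≡n! {n} {k} k≤n = trans (cong (_* (k ! * (n ∸ k) !)) (nCk≡n!/k![n-k]! k≤n))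
                                       (m/n*n≡m {{k !* (n ∸ k) !≢0}} (k![n∸k]!∣n! k≤n))

nCk>0 : ∀ {n k} → k ≤ n → n C k > 0
nCk>0 {n} {k} k≤n with n C k | nCk*[k!*[n∸k]!]≡n! k≤n
... | zero  | 0≡n! = contradiction (sym 0≡n!) (≢-nonZero⁻¹ _ {{n !≢0}})
... | suc _ | _    = z<s

[2k+1]Ck≡[2k+1]C[1+k] : ∀ k → suc (k + k) C k ≡ suc (k + k) C suc k
[2k+1]Ck≡[2k+1]C[1+k] k = trans (nCk≡nC[n∸k] (m≤n⇒m≤1+n (m≤m+n k k)))
                                (cong (suc (k + k) C_) (trans (+-∸-assoc 1 (m≤m+n k k)) (cong suc (m+n∸n≡m k k))))

[2k+2]C[1+k]≡2*[2k+1]C[1+k] : ∀ k → (suc k + suc k) C suc k ≡ 2 * (suc (k + k) C suc k)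
[2k+2]C[1+k]≡2*[2k+1]C[1+k] k = begin
  (suc k + suc k) C suc k                           ≡⟨ cong (λ n → suc n C suc k) (+-suc k k) ⟩
  suc (suc (k + k)) C suc k                         ≡⟨ nCk+nC[k+1]≡[n+1]C[k+1] (suc (k + k)) k ⟨
  suc (k + k) C k + suc (k + k) C suc k             ≡⟨ cong (_+ suc (k + k) C suc k) ([2k+1]Ck≡[2k+1]C[1+k] k) ⟩
  suc (k + k) C suc k + suc (k + k) C suc k         ≡⟨ cong (suc (k + k) C suc k +_) (+-identityʳ _) ⟨
  2 * (suc (k + k) C suc k)                         ∎
  where open ≡-Reasoning

[1+k]*[2k+2]C[1+k]≡2*[2k+1]*[2k]Ck : ∀ k → suc k * ((suc k + suc k) C suc k) ≡ 2 * (suc (k + k) * ((k + k) C k))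
[1+k]*[2k+2]C[1+k]≡2*[2k+1]*[2k]Ck k = begin
  suc k * ((suc k + suc k) C suc k)     ≡⟨ cong (suc k *_) ([2k+2]C[1+k]≡2*[2k+1]C[1+k] k) ⟩
  suc k * (2 * (suc (k + k) C suc k))   ≡⟨ x*[2*y]≡2*[x*y] (suc k) (suc (k + k) C suc k) ⟩
  2 * (suc k * (suc (k + k) C suc k))   ≡⟨ cong (2 *_) ([1+k]*[1+n]C[1+k]≡[1+n]*nCk (k + k) k) ⟩
  2 * (suc (k + k) * ((k + k) C k))     ∎
  where
  open ≡-Reasoning
  x*[2*y]≡2*[x*y] : ∀ x y → x * (2 * y) ≡ 2 * (x * y)
  x*[2*y]≡2*[x*y] = solve-∀

4^[1+k]≤2*[1+k]*[2k+2]C[1+k] : ∀ k → 4 ^ suc k ≤ 2 * (suc k * ((suc k + suc k) C suc k))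
4^[1+k]≤2*[1+k]*[2k+2]C[1+k] zero    = ≤-refl
4^[1+k]≤2*[1+k]*[2k+2]C[1+k] (suc k) = begin
  4 * 4 ^ suc k                                  ≤⟨ *-monoʳ-≤ 4 (4^[1+k]≤2*[1+k]*[2k+2]C[1+k] k) ⟩
  4 * (2 * (suc k * c))                          ≤⟨ grow (suc k) c ⟩
  2 * (2 * (suc (suc k + suc k) * c))            ≡⟨ cong (2 *_) ([1+k]*[2k+2]C[1+k]≡2*[2k+1]*[2k]Ck (suc k)) ⟨
  2 * (suc (suc k) * ((suc (suc k) + suc (suc k)) C suc (suc k)))  ∎
  where
  open ≤-Reasoning
  c = (suc k + suc k) C suc k
  grow : ∀ a c → 4 * (2 * (a * c)) ≤ 2 * (2 * (suc (a + a) * c))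
  grow a c = subst (4 * (2 * (a * c)) ≤_) (sym (eq a c)) (m≤m+n _ (4 * c))
    where
    eq : ∀ a c → 2 * (2 * (suc (a + a) * c)) ≡ 4 * (2 * (a * c)) + 4 * c
    eq = solve-∀

[2k+1]C[1+k]≤4^k : ∀ k → suc (k + k) C suc k ≤ 4 ^ k
[2k+1]C[1+k]≤4^k zero    = ≤-refl
[2k+1]C[1+k]≤4^k (suc k) = *-cancelˡ-≤ (suc (suc k)) (begin
  suc (suc k) * (suc (suc k + suc k) C suc (suc k))  ≡⟨ [1+k]*[1+n]C[1+k]≡[1+n]*nCk (suc k + suc k) (suc k) ⟩
  suc (suc k + suc k) * ((suc k + suc k) C suc k)    ≡⟨ cong (suc (suc k + suc k) *_) ([2k+2]C[1+k]≡2*[2k+1]C[1+k] k) ⟩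
  suc (suc k + suc k) * (2 * b)                      ≤⟨ shrink k b ⟩
  suc (suc k) * (4 * b)                              ≤⟨ *-monoʳ-≤ (suc (suc k)) (*-monoʳ-≤ 4 ([2k+1]C[1+k]≤4^k k)) ⟩
  suc (suc k) * (4 * 4 ^ k)                          ∎)
  where
  open ≤-Reasoning
  b = suc (k + k) C suc k
  shrink : ∀ k b → suc (suc k + suc k) * (2 * b) ≤ suc (suc k) * (4 * b)
  shrink k b = subst (suc (suc k + suc k) * (2 * b) ≤_) (sym (eq k b)) (m≤m+n _ (2 * b))
    where
    eq : ∀ k b → suc (suc k) * (4 * b) ≡ suc (suc k + suc k) * (2 * b) + 2 * b
    eq = solve-∀

-- 1/c = 1/a − 1/b, hence L/c = L/a − L/b.
reciprocalDifference-∣ : ∀ {a b c L} .{{_ : NonZero (a * b)}} → a * (b + c) ≡ b * c → a ∣ L → b ∣ L → c ∣ L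
reciprocalDifference-∣ {a} {b} {c} {L} a[b+c]≡bc (divides u L≡ua) (divides v L≡vb) =
  ∣m+n∣m⇒∣n (subst (c ∣_) (sym cv+L≡cu) (m∣m*n u)) (m∣m*n v)
  where
  open ≡-Reasoning
  ab[cv+L]≡ab[cu] : a * b * (c * v + L) ≡ a * b * (c * u)
  ab[cv+L]≡ab[cu] = begin
    a * b * (c * v + L)       ≡⟨ cong (λ t → a * b * (c * v + t)) L≡vb ⟩
    a * b * (c * v + v * b)   ≡⟨ solve₁ a b c v ⟩
    (v * b) * (a * (b + c))   ≡⟨ cong₂ _*_ (sym L≡vb) a[b+c]≡bc ⟩
    L * (b * c)               ≡⟨ cong (_* (b * c)) L≡ua ⟩
    (u * a) * (b * c)         ≡⟨ solve₂ a b c u ⟩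
    a * b * (c * u)           ∎
    where
    solve₁ : ∀ a b c v → a * b * (c * v + v * b) ≡ (v * b) * (a * (b + c))
    solve₁ = solve-∀
    solve₂ : ∀ a b c u → (u * a) * (b * c) ≡ a * b * (c * u)
    solve₂ = solve-∀
  cv+L≡cu : c * v + L ≡ c * u
  cv+L≡cu = *-cancelˡ-≡ (c * v + L) (c * u) (a * b) ab[cv+L]≡ab[cu]

-- Leibniz's harmonic triangle: 1/((k+1)·C(n+1,k+1)) = 1/(k·C(n,k)) − 1/(k·C(n+1,k)).
m*nCm∣L : ∀ n L → (∀ j → j > 0 → j ≤ n → j ∣ L) → ∀ m → m > 0 → m ≤ n → m * (n C m) ∣ L
m*nCm∣L zero    L _   m m>0 m≤0 = contradiction m≤0 (<⇒≱ m>0)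
m*nCm∣L (suc n) L j∣L = row
  where
  previousRow : ∀ m → m > 0 → m ≤ n → m * (n C m) ∣ L
  previousRow = m*nCm∣L n L (λ j j>0 j≤n → j∣L j j>0 (m≤n⇒m≤1+n j≤n))
  row : ∀ m → m > 0 → m ≤ suc n → m * (suc n C m) ∣ L
  row 1 _ _ = subst (_∣ L) (sym (trans (+-identityʳ _) (nC1≡n (suc n)))) (j∣L (suc n) z<s ≤-refl)
  row (suc (suc k)) _ (s≤s 1+k≤n) =
    subst (_∣ L) (sym ([1+k]*[1+n]C[1+k]≡[1+n]*nCk n (suc k)))
      (reciprocalDifference-∣ {{>-nonZero (*-mono-< a>0 b>0)}} a[b+c]≡bc
        (previousRow (suc k) z<s 1+k≤n) (row (suc k) z<s (m≤n⇒m≤1+n 1+k≤n)))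
    where
    a = suc k * (n C suc k)
    b = suc k * (suc n C suc k)
    c = suc n * (n C suc k)
    a>0 : a > 0
    a>0 = *-mono-< (z<s {k}) (nCk>0 1+k≤n)
    b>0 : b > 0
    b>0 = *-mono-< (z<s {k}) (nCk>0 (m≤n⇒m≤1+n 1+k≤n))
    a[b+c]≡bc : a * (b + c) ≡ b * c
    a[b+c]≡bc = begin
      a * (b + c)                                   ≡⟨ cong (a *_) ([1+k]*[1+n]C[1+k]+[1+n]*nC[1+k]≡[1+n]*[1+n]C[1+k] n k) ⟩
      suc k * (n C suc k) * (suc n * (suc n C suc k)) ≡⟨ swap (suc k) (n C suc k) (suc n) (suc n C suc k) ⟩
      b * c                                         ∎
      where
      open ≡-Reasoning
      swap : ∀ x y z w → x * y * (z * w) ≡ x * w * (z * y)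
      swap = solve-∀

prime⇒>1 : ∀ {p} → Prime p → p > 1
prime⇒>1 {p} pr = nonTrivial⇒n>1 p {{prime⇒nonTrivial pr}}

prime∤n! : ∀ {p} → Prime p → ∀ n → n < p → p ∤ n !
prime∤n! pr zero    _   = >⇒∤ (prime⇒>1 pr)
prime∤n! pr (suc n) n<p p∣n! with euclidsLemma (suc n) (n !) pr p∣n!
... | inj₁ p∣1+n = >⇒∤ n<p p∣1+n
... | inj₂ p∣n!  = prime∤n! pr n (<-trans (n<1+n n) n<p) p∣n!

primeFactor : ∀ j → j > 1 → ∃[ q ] (Prime q × q ∣ j)
primeFactor j@(suc _) j>1 with factorise j
... | record { factors = [] ; isFactorisation = j≡1 } = contradiction j≡1 (>⇒≢ j>1)
... | record { factors = q ∷ qs ; isFactorisation = j≡q*qs ; factorsPrime = q-prime ∷ _ } =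
  q , q-prime , subst (q ∣_) (sym j≡q*qs) (m∣m*n (product qs))

¬prime[k+k] : ∀ k → k ≥ 2 → ¬ Prime (k + k)
¬prime[k+k] k k≥2 = composite⇒¬prime (composite {d = 2} 2<k+k (divides k k+k≡k*2))
  where
  2<k+k : 2 < k + k
  2<k+k = +-mono-<-≤ k≥2 (≤-trans (s≤s z≤n) k≥2)
  k+k≡k*2 : k + k ≡ k * 2
  k+k≡k*2 = trans (cong (k +_) (sym (+-identityʳ k))) (*-comm 2 k)

πn≤n : ∀ n → π n ≤ n
πn≤n zero = z≤n
πn≤n (suc n) with prime? (suc n)
... | yes _ = s≤s (πn≤n n)
... | no  _ = m≤n⇒m≤1+n (πn≤n n)

πn≤π[n+d] : ∀ n d → π n ≤ π (n + d)
πn≤π[n+d] n zero    rewrite +-identityʳ n = ≤-refl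
πn≤π[n+d] n (suc d) rewrite +-suc n d with prime? (suc (n + d))
... | yes _ = m≤n⇒m≤1+n (πn≤π[n+d] n d)
... | no  _ = πn≤π[n+d] n d

primeProduct : ℕ → ℕ → ℕ
primeProduct a zero = 1
primeProduct a (suc j) with prime? (suc (a + j))
... | yes _ = primeProduct a j * suc (a + j)
... | no  _ = primeProduct a j

primeProduct>0 : ∀ a j → primeProduct a j > 0
primeProduct>0 a zero    = z<s
primeProduct>0 a (suc j) with prime? (suc (a + j))
... | yes _ = *-mono-≤ (primeProduct>0 a j) (s≤s z≤n)
... | no  _ = primeProduct>0 a j

primeProduct-+ : ∀ a j → primeProduct 0 (a + j) ≡ primeProduct 0 a * primeProduct a j
primeProduct-+ a zero    rewrite +-identityʳ a = sym (*-identityʳ (primeProduct 0 a))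
primeProduct-+ a (suc j) rewrite +-suc a j with prime? (suc (a + j))
... | yes _ rewrite primeProduct-+ a j = *-assoc (primeProduct 0 a) (primeProduct a j) (suc (a + j))
... | no  _ = primeProduct-+ a j

primeProduct∣[a+j]! : ∀ a j → primeProduct a j ∣ (a + j) !
primeProduct∣[a+j]! a zero    = 1∣ _
primeProduct∣[a+j]! a (suc j) rewrite +-suc a j with prime? (suc (a + j))
... | yes _ = subst (primeProduct a j * suc (a + j) ∣_) (*-comm ((a + j) !) (suc (a + j)))
                    (*-monoˡ-∣ (suc (a + j)) (primeProduct∣[a+j]! a j))
... | no  _ = ∣-trans (primeProduct∣[a+j]! a j) (n∣m*n (suc (a + j)))

-- Every prime factor of primeProduct a j exceeds a ≥ n, so it does not divide n!.
primeProduct∣m*n!⇒primeProduct∣m : ∀ {a n} → n ≤ a → ∀ j m → primeProduct a j ∣ m * n ! → primeProduct a j ∣ m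
primeProduct∣m*n!⇒primeProduct∣m n≤a zero    m _ = 1∣ m
primeProduct∣m*n!⇒primeProduct∣m {a} {n} n≤a (suc j) m P∣m*n! with prime? (suc (a + j))
... | no  _ = primeProduct∣m*n!⇒primeProduct∣m n≤a j m P∣m*n!
... | yes pr with euclidsLemma m (n !) pr (∣-trans (n∣m*n (primeProduct a j)) P∣m*n!)
...   | inj₂ p∣n! = contradiction p∣n! (prime∤n! pr n (s≤s (≤-trans n≤a (m≤m+n a j))))
...   | inj₁ (divides m′ refl) = *-monoˡ-∣ p (primeProduct∣m*n!⇒primeProduct∣m n≤a j m′ (*-cancelʳ-∣ p P*p∣m′*n!*p))
  where
  p = suc (a + j)
  P*p∣m′*n!*p : primeProduct a j * p ∣ (m′ * n !) * p
  P*p∣m′*n!*p = subst (primeProduct a j * p ∣_) (swap m′ p (n !)) P∣m*n!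
    where
    swap : ∀ x y z → (x * y) * z ≡ (x * z) * y
    swap = solve-∀

primeProduct[1+k,k]∣[2k+1]C[1+k] : ∀ k → primeProduct (suc k) k ∣ suc (k + k) C suc k
primeProduct[1+k,k]∣[2k+1]C[1+k] k =
  primeProduct∣m*n!⇒primeProduct∣m ≤-refl k b
    (primeProduct∣m*n!⇒primeProduct∣m (n≤1+n k) k (b * suc k !)
      (subst (primeProduct (suc k) k ∣_) (sym b*[1+k]!*k!≡[2k+1]!) (primeProduct∣[a+j]! (suc k) k)))
  where
  open ≡-Reasoning
  b = suc (k + k) C suc k
  b*[1+k]!*k!≡[2k+1]! : b * suc k ! * k ! ≡ suc (k + k) !
  b*[1+k]!*k!≡[2k+1]! = begin
    b * suc k ! * k !                  ≡⟨ *-assoc b (suc k !) (k !) ⟩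
    b * (suc k ! * k !)                ≡⟨ cong (λ i → b * (suc k ! * i !)) (m+n∸n≡m k k) ⟨
    b * (suc k ! * (k + k ∸ k) !)      ≡⟨ nCk*[k!*[n∸k]!]≡n! (s≤s (m≤n+m k k)) ⟩
    suc (k + k) !                      ∎

primeProduct[1+k,k]≤4^k : ∀ k → primeProduct (suc k) k ≤ 4 ^ k
primeProduct[1+k,k]≤4^k k = ≤-trans (∣⇒≤ {{>-nonZero (nCk>0 (s≤s (m≤n+m k k)))}} (primeProduct[1+k,k]∣[2k+1]C[1+k] k))
                                     ([2k+1]C[1+k]≤4^k k)

primeProduct0n≤4^n : ∀ n → primeProduct 0 n ≤ 4 ^ n
primeProduct0n≤4^n n = go n (<-wellFounded n)
  where
  open ≤-Reasoning
  go : ∀ n → Acc _<_ n → primeProduct 0 n ≤ 4 ^ n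
  go n (acc rec) with even⊎odd n
  ... | 0 , inj₁ refl = ≤-refl
  ... | 1 , inj₁ refl = s≤s (s≤s z≤n)
  ... | suc (suc i) , inj₁ refl with prime? (suc (suc i) + suc (suc i))
  ...   | yes pr = contradiction pr (¬prime[k+k] (suc (suc i)) (s≤s (s≤s z≤n)))
  ...   | no  _  = ≤-trans (go _ (rec ≤-refl)) (m≤n*m _ 4)
  go n (acc rec) | 0 , inj₂ refl = s≤s z≤n
  go n (acc rec) | suc k , inj₂ refl = begin
    primeProduct 0 (suc (suc k) + suc k)              ≡⟨ primeProduct-+ (suc (suc k)) (suc k) ⟩
    primeProduct 0 (suc (suc k)) * primeProduct (suc (suc k)) (suc k)
      ≤⟨ *-mono-≤ (go (suc (suc k)) (rec (s≤s (s≤s (m≤n+m (suc k) k))))) (primeProduct[1+k,k]≤4^k (suc k)) ⟩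
    4 ^ suc (suc k) * 4 ^ suc k                       ≡⟨ ^-distribˡ-+-* 4 (suc (suc k)) (suc k) ⟨
    4 ^ (suc (suc k) + suc k)                         ∎

[1+a]^[π[a+j]∸πa]≤primeProduct : ∀ a j → suc a ^ (π (a + j) ∸ π a) ≤ primeProduct a j
[1+a]^[π[a+j]∸πa]≤primeProduct a zero rewrite +-identityʳ a | n∸n≡0 (π a) = ≤-refl
[1+a]^[π[a+j]∸πa]≤primeProduct a (suc j) rewrite +-suc a j with prime? (suc (a + j))
... | no  _ = [1+a]^[π[a+j]∸πa]≤primeProduct a j
... | yes _ rewrite +-∸-assoc 1 (πn≤π[n+d] a j) =
  subst (_≤ primeProduct a j * suc (a + j)) (*-comm (suc a ^ (π (a + j) ∸ π a)) (suc a))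
        (*-mono-≤ ([1+a]^[π[a+j]∸πa]≤primeProduct a j) (s≤s (m≤m+n a j)))

-- With y = 4^(2m), the c = π(mb) − π(y) primes in (y, mb] have product ≥ y^c = 4^(2mc)
-- and ≤ 4^(mb), so 2c ≤ b; and π(y) ≤ y ≤ b/2.
π[m*b]≤b : ∀ m b → .{{NonZero m}} → 2 * 4 ^ (2 * m) ≤ b → π (m * b) ≤ b
π[m*b]≤b m b 2y≤b = *-cancelˡ-≤ 2 (begin
  2 * π x              ≤⟨ *-monoʳ-≤ 2 (m≤n+m∸n (π x) (π y)) ⟩
  2 * (π y + c)        ≤⟨ *-monoʳ-≤ 2 (+-monoˡ-≤ c (πn≤n y)) ⟩
  2 * (y + c)          ≡⟨ *-distribˡ-+ 2 y c ⟩
  2 * y + 2 * c        ≤⟨ +-mono-≤ 2y≤b 2c≤b ⟩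
  b + b                ≡⟨ cong (b +_) (+-identityʳ b) ⟨
  2 * b                ∎)
  where
  open ≤-Reasoning
  y = 4 ^ (2 * m)
  x = m * b
  c = π x ∸ π y
  y≤x : y ≤ x
  y≤x = ≤-trans (m≤n*m y 2) (≤-trans 2y≤b (m≤n*m b m))
  y+[x∸y]≡x : y + (x ∸ y) ≡ x
  y+[x∸y]≡x = m+[n∸m]≡n y≤x
  4^[2mc]≤4^x : 4 ^ (2 * m * c) ≤ 4 ^ x
  4^[2mc]≤4^x = begin
    4 ^ (2 * m * c)                        ≡⟨ ^-*-assoc 4 (2 * m) c ⟨
    y ^ c                                  ≤⟨ ^-monoˡ-≤ c (n≤1+n y) ⟩
    suc y ^ c                              ≡⟨ cong (λ z → suc y ^ (π z ∸ π y)) y+[x∸y]≡x ⟨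
    suc y ^ (π (y + (x ∸ y)) ∸ π y)        ≤⟨ [1+a]^[π[a+j]∸πa]≤primeProduct y (x ∸ y) ⟩
    primeProduct y (x ∸ y)                 ≤⟨ m≤n*m _ (primeProduct 0 y) {{>-nonZero (primeProduct>0 0 y)}} ⟩
    primeProduct 0 y * primeProduct y (x ∸ y) ≡⟨ primeProduct-+ y (x ∸ y) ⟨
    primeProduct 0 (y + (x ∸ y))           ≤⟨ primeProduct0n≤4^n (y + (x ∸ y)) ⟩
    4 ^ (y + (x ∸ y))                      ≡⟨ cong (4 ^_) y+[x∸y]≡x ⟩
    4 ^ x                                  ∎
  2c≤b : 2 * c ≤ b
  2c≤b = *-cancelˡ-≤ m (subst (_≤ x) (2*m*c≡m*[2*c] m c) (^-cancelʳ-≤ 4 (s≤s (s≤s z≤n)) 4^[2mc]≤4^x))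
    where
    2*m*c≡m*[2*c] : ∀ m c → 2 * m * c ≡ m * (2 * c)
    2*m*c≡m*[2*c] = solve-∀

Smooth : ℕ → ℕ → Set
Smooth i j = ∀ {q} → Prime q → q ∣ j → q ≤ i

-- The multiple is ∏ p^k over primes p ≤ i, with p^k the largest power of p not exceeding n.
smoothCommonMultiple : ∀ n → n > 0 → ∀ i →
  ∃[ D ] (D > 0 × D ≤ n ^ π i × (∀ j → j > 0 → j ≤ n → Smooth i j → j ∣ D))
smoothCommonMultiple n n>0 zero = 1 , z<s , ≤-refl , 1-smooth
  where
  1-smooth : ∀ j → j > 0 → j ≤ n → Smooth 0 j → j ∣ 1
  1-smooth 1 _ _ _ = ∣-refl
  1-smooth (suc (suc j)) _ _ smooth with primeFactor (suc (suc j)) (s≤s (s≤s z≤n))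
  ... | q , q-prime , q∣j = contradiction (smooth q-prime q∣j) (<⇒≱ (<-trans z<s (prime⇒>1 q-prime)))
smoothCommonMultiple n@(suc n-1) n>0 (suc i) with smoothCommonMultiple n n>0 i | prime? (suc i)
... | D , D>0 , D≤n^πi , D-multiple | no ¬prime = D , D>0 , D≤n^πi , λ j j>0 j≤n smooth →
  D-multiple j j>0 j≤n (λ q-prime q∣j → ≤-pred (≤∧≢⇒< (smooth q-prime q∣j) (λ { refl → ¬prime q-prime })))
... | D , D>0 , D≤n^πi , D-multiple | yes p-prime with maxPower (suc i) (prime⇒>1 p-prime) n-1
...   | k , p^k≤n , n<p^[1+k] = D * p ^ k , *-mono-≤ D>0 (m^n>0 p k) , D*p^k≤n^[1+πi] , D*p^k-multiple
  where
  p = suc i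
  D*p^k≤n^[1+πi] : D * p ^ k ≤ n ^ suc (π i)
  D*p^k≤n^[1+πi] = subst (D * p ^ k ≤_) (*-comm (n ^ π i) n) (*-mono-≤ D≤n^πi p^k≤n)
  D*p^k-multiple : ∀ j → j > 0 → j ≤ n → Smooth p j → j ∣ D * p ^ k
  D*p^k-multiple j j>0 j≤n smooth with factorOutPower p (prime⇒>1 p-prime) j j>0
  ... | a , r , j≡p^a*r , p∤r =
    subst (_∣ D * p ^ k) (sym j≡p^a*r) (subst (p ^ a * r ∣_) (*-comm (p ^ k) D) (*-pres-∣ p^a∣p^k r∣D))
    where
    p^a∣j : p ^ a ∣ j
    p^a∣j = divides r (trans j≡p^a*r (*-comm (p ^ a) r))
    r∣j : r ∣ j
    r∣j = divides (p ^ a) j≡p^a*r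
    r>0 : r > 0
    r>0 = n≢0⇒n>0 λ { refl → <⇒≢ j>0 (sym (trans j≡p^a*r (*-zeroʳ (p ^ a)))) }
    r∣D : r ∣ D
    r∣D = D-multiple r r>0 (≤-trans (∣⇒≤ {{>-nonZero j>0}} r∣j) j≤n)
            (λ q-prime q∣r → ≤-pred (≤∧≢⇒< (smooth q-prime (∣-trans q∣r r∣j)) (λ { refl → p∤r q∣r })))
    a≤k : a ≤ k
    a≤k = ≤-pred (^-cancelʳ-< p (≤-<-trans (≤-trans (∣⇒≤ {{>-nonZero j>0}} p^a∣j) j≤n) n<p^[1+k]))
    p^a∣p^k : p ^ a ∣ p ^ k
    p^a∣p^k = ^-monoʳ-∣ p a≤k

4^[1+k]≤2*[2k+2]^π[2k+2] : ∀ k → 4 ^ suc k ≤ 2 * ((suc k + suc k) ^ π (suc k + suc k))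
4^[1+k]≤2*[2k+2]^π[2k+2] k with smoothCommonMultiple (suc k + suc k) z<s (suc k + suc k)
... | D , D>0 , D≤n^πn , D-multiple = begin
  4 ^ suc k                    ≤⟨ 4^[1+k]≤2*[1+k]*[2k+2]C[1+k] k ⟩
  2 * (suc k * (n C suc k))    ≤⟨ *-monoʳ-≤ 2 (∣⇒≤ {{>-nonZero D>0}} (m*nCm∣L n D j∣D (suc k) z<s (m≤m+n (suc k) (suc k)))) ⟩
  2 * D                        ≤⟨ *-monoʳ-≤ 2 D≤n^πn ⟩
  2 * (n ^ π n)                ∎
  where
  open ≤-Reasoning
  n = suc k + suc k
  j∣D : ∀ j → j > 0 → j ≤ n → j ∣ D
  j∣D j j>0 j≤n = D-multiple j j>0 j≤n (λ _ q∣j → ≤-trans (∣⇒≤ {{>-nonZero j>0}} q∣j) j≤n)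

[Y+Y]≤K*s : ∀ Y K s → Y > 0 → Y + Y ≤ 2 ^ K → π (Y + Y) < s → Y + Y ≤ K * s
[Y+Y]≤K*s (suc k) K s _ X≤2^K πX<s = ^-cancelʳ-≤ 2 (s≤s (s≤s z≤n)) (begin
  2 ^ X               ≡⟨ cong (λ i → 2 ^ (suc k + i)) (+-identityʳ (suc k)) ⟨
  2 ^ (2 * suc k)     ≡⟨ ^-*-assoc 2 2 (suc k) ⟨
  4 ^ suc k           ≤⟨ 4^[1+k]≤2*[2k+2]^π[2k+2] k ⟩
  2 * (X ^ π X)       ≤⟨ *-monoˡ-≤ (X ^ π X) 2≤X ⟩
  X ^ suc (π X)       ≤⟨ ^-monoʳ-≤ X πX<s ⟩
  X ^ s               ≤⟨ ^-monoˡ-≤ s X≤2^K ⟩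
  (2 ^ K) ^ s         ≡⟨ ^-*-assoc 2 K s ⟩
  2 ^ (K * s)         ∎)
  where
  open ≤-Reasoning
  X = suc k + suc k
  2≤X : 2 ≤ X
  2≤X = s≤s (≤-trans (s≤s z≤n) (m≤n+m (suc k) k))

-- For 2^q ≤ m < 2^(q+1) take a = 2^(q+1): if π(ma) < m + a, the Chebyshev lower bound
-- forces ma ≤ K(m + a) ≤ 3Km with K = 2q + 2, i.e. 2^(q+1) ≤ 6(q+1), false once m ≥ 16.
m+a≤π[m*a]-large : ∀ m → m ≥ 16 → ∃[ a ] (a > 0 × m + a ≤ π (m * a))
m+a≤π[m*a]-large m@(suc m-1) m≥16 with maxPower 2 (s≤s (s≤s z≤n)) m-1
... | q , 2^q≤m , m<2^[1+q] = a , m^n>0 2 (suc q) , ≮⇒≥ (λ π[ma]<m+a → <⇒≱ 3K<a (a≤3K π[ma]<m+a))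
  where
  open ≤-Reasoning
  a = 2 ^ suc q
  K = suc q + suc q
  Y = m * 2 ^ q
  ma≡Y+Y : m * a ≡ Y + Y
  ma≡Y+Y = x*[2*y]≡x*y+x*y m (2 ^ q)
    where
    x*[2*y]≡x*y+x*y : ∀ x y → x * (2 * y) ≡ x * y + x * y
    x*[2*y]≡x*y+x*y = solve-∀
  Y+Y≤2^K : Y + Y ≤ 2 ^ K
  Y+Y≤2^K = begin
    Y + Y      ≡⟨ ma≡Y+Y ⟨
    m * a      ≤⟨ *-monoˡ-≤ a (<⇒≤ m<2^[1+q]) ⟩
    a * a      ≡⟨ ^-distribˡ-+-* 2 (suc q) (suc q) ⟨
    2 ^ K      ∎
  a≤3K : π (m * a) < m + a → a ≤ 3 * K
  a≤3K π[ma]<m+a = *-cancelˡ-≤ m (begin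
    m * a          ≡⟨ ma≡Y+Y ⟩
    Y + Y          ≤⟨ [Y+Y]≤K*s Y K (m + a) (*-mono-< (≤-trans z<s m≥16) (m^n>0 2 q)) Y+Y≤2^K
                                    (subst (λ x → π x < m + a) ma≡Y+Y π[ma]<m+a) ⟩
    K * (m + a)    ≤⟨ *-monoʳ-≤ K (+-monoʳ-≤ m (*-monoʳ-≤ 2 2^q≤m)) ⟩
    K * (m + 2 * m) ≡⟨ rearrange K m ⟩
    m * (3 * K)    ∎)
    where
    rearrange : ∀ K m → K * (m + 2 * m) ≡ m * (3 * K)
    rearrange = solve-∀
  3K<a : 3 * K < a
  3K<a = 3*[n+n]<2^n (suc q) (^-cancelʳ-< 2 (≤-<-trans m≥16 m<2^[1+q]))

m+a≤π[m*a] : ∀ m → m > 4 → ∃[ a ] (a > 0 × m + a ≤ π (m * a))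
m+a≤π[m*a] 0  ()
m+a≤π[m*a] 1  (s≤s ())
m+a≤π[m*a] 2  (s≤s (s≤s ()))
m+a≤π[m*a] 3  (s≤s (s≤s (s≤s ())))
m+a≤π[m*a] 4  (s≤s (s≤s (s≤s (s≤s ()))))
m+a≤π[m*a] 5  _ = 9 , z<s , ≤ᵇ⇒≤ 14 (π 45) _
m+a≤π[m*a] 6  _ = 7 , z<s , ≤ᵇ⇒≤ 13 (π 42) _
m+a≤π[m*a] 7  _ = 6 , z<s , ≤ᵇ⇒≤ 13 (π 42) _
m+a≤π[m*a] 8  _ = 6 , z<s , ≤ᵇ⇒≤ 14 (π 48) _
m+a≤π[m*a] 9  _ = 5 , z<s , ≤ᵇ⇒≤ 14 (π 45) _
m+a≤π[m*a] 10 _ = 5 , z<s , ≤ᵇ⇒≤ 15 (π 50) _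
m+a≤π[m*a] 11 _ = 5 , z<s , ≤ᵇ⇒≤ 16 (π 55) _
m+a≤π[m*a] 12 _ = 5 , z<s , ≤ᵇ⇒≤ 17 (π 60) _
m+a≤π[m*a] 13 _ = 5 , z<s , ≤ᵇ⇒≤ 18 (π 65) _
m+a≤π[m*a] 14 _ = 5 , z<s , ≤ᵇ⇒≤ 19 (π 70) _
m+a≤π[m*a] 15 _ = 5 , z<s , ≤ᵇ⇒≤ 20 (π 75) _
m+a≤π[m*a] m@(suc (suc (suc (suc (suc (suc (suc (suc (suc (suc (suc (suc (suc (suc (suc (suc _)))))))))))))))) _ =
  m+a≤π[m*a]-large m (≤ᵇ⇒≤ 16 m _)

π[m*n]≡m+n-between : ∀ m a d → a > 0 → m + a ≤ π (m * a) → π (m * (a + d)) ≤ m + (a + d) →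
                     ∃[ n ] (0 < n × π (m * n) ≡ m + n)
π[m*n]≡m+n-between m a zero    a>0 lo hi rewrite +-identityʳ a = a , a>0 , ≤-antisym hi lo
π[m*n]≡m+n-between m a (suc d) a>0 lo hi with π (m * a) ≟ m + a
... | yes eq = a , a>0 , eq
... | no  ne = π[m*n]≡m+n-between m (suc a) d z<s lo′ (subst (λ t → π (m * t) ≤ m + t) (+-suc a d) hi)
  where
  open ≤-Reasoning
  lo′ : m + suc a ≤ π (m * suc a)
  lo′ = begin
    m + suc a           ≡⟨ +-suc m a ⟩
    suc (m + a)         ≤⟨ ≤∧≢⇒< lo (ne ∘ sym) ⟩
    π (m * a)           ≤⟨ πn≤π[n+d] (m * a) m ⟩
    π (m * a + m)       ≡⟨ cong π (trans (+-comm (m * a) m) (sym (*-suc m a))) ⟩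
    π (m * suc a)       ∎

corollary1p2 : ∀ (m : ℕ) → m > 4 → ∃[ n ] (0 < n × π (m * n) ≡ m + n)
corollary1p2 m m>4 with m+a≤π[m*a] m m>4
... | a , a>0 , m+a≤π[ma] = π[m*n]≡m+n-between m a d a>0 m+a≤π[ma] π[m*[a+d]]≤m+[a+d]
  where
  instance
    _ = >-nonZero (<-trans z<s m>4)
  d = 2 * 4 ^ (2 * m)
  π[m*[a+d]]≤m+[a+d] : π (m * (a + d)) ≤ m + (a + d)
  π[m*[a+d]]≤m+[a+d] = ≤-trans (π[m*b]≤b m (a + d) (m≤n+m d a)) (m≤n+m (a + d) m)
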